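{- Let $t\geq 2$ and let $\Gamma$ be a $t$-walk-regular graph with valency $k$ and odd-girth $2s+1$. If $\Gamma$ is not complete multipartite, then the distance-$2$ graph $\Gamma_2$ of $\Gamma$ is $\min\{\lfloor s/2\rfloor,\lfloor t/2\rfloor\}$-walk-regular.
   Context: All graphs are finite, simple and connected. For $r\geq 0$, a graph is $r$-walk-regular if it has diameter at least $r$ and for every $\ell\geq0$ the number of walks of length $\ell$ between vertices $x$ and $y$ depends only on $\mathrm{dist}(x,y)$ whenever $\mathrm{dist}(x,y)\leq r$. The odd-girth is the length of a shortest odd cycle. The distance-$2$ graph $\Gamma_2$ has the same vertex set as $\Gamma$, two vertices being adjacent iff they are at distance $2$ in $\Gamma$. -}

module Defs where

open import Data.Nat using (ℕ; zero; suc; _+_; _*_; _≤_; _<_)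
open import Data.Nat.Properties using (_≟_)
open import Data.Bool using (Bool; true; false; if_then_else_; _∧_; _∨_; not)
open import Data.Bool.Properties using (∧-comm)
open import Data.Empty using (⊥-elim)
open import Data.Fin using (Fin)
import Data.Fin as F
open import Data.List using (List; []; _∷_; map; allFin)
open import Data.Nat.ListAction using (sum)
open import Data.Bool.ListAction using (any)
open import Data.Product using (Σ; ∃; _×_; _,_)
open import Relation.Binary.PropositionalEquality using (_≡_; _≢_; refl; cong; cong₂; trans) renaming (sym to ≡-sym)
open import Relation.Nullary using (¬_; does; yes; no)
open import Function.Bundles using (_⇔_)

record Graph : Set where
  field
    n      : ℕ
    adj    : Fin n → Fin n → Bool
    sym    : ∀ x y → adj x y ≡ adj y x
    irrefl : ∀ x → adj x x ≡ false

module _ (G : Graph) where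
  open Graph G

  Adj : Fin n → Fin n → Set
  Adj x y = adj x y ≡ true

  data Walk : ℕ → Fin n → Fin n → Set where
    here : ∀ {x} → Walk 0 x x
    step : ∀ {ℓ x z y} → Adj x z → Walk ℓ z y → Walk (suc ℓ) x y

  Connected : Set
  Connected = ∀ x y → ∃ λ ℓ → Walk ℓ x y

  Dist : Fin n → Fin n → ℕ → Set
  Dist x y d = Walk d x y × (∀ ℓ → ℓ < d → ¬ Walk ℓ x y)

  -- dist(x,y) ≥ r (also covering dist = ∞ in a disconnected graph)
  DistAtLeast : Fin n → Fin n → ℕ → Set
  DistAtLeast x y r = ∀ ℓ → ℓ < r → ¬ Walk ℓ x y

  DiameterAtLeast : ℕ → Set
  DiameterAtLeast r = Σ (Fin n) λ x → Σ (Fin n) λ y → DistAtLeast x y r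

  walks : ℕ → Fin n → Fin n → ℕ
  walks zero    x y = if does (x F.≟ y) then 1 else 0
  walks (suc ℓ) x y = sum (map (λ z → if adj x z then walks ℓ z y else 0) (allFin n))

  degree : Fin n → ℕ
  degree x = sum (map (λ z → if adj x z then 1 else 0) (allFin n))

  Regular : ℕ → Set
  Regular k = ∀ x → degree x ≡ k

  WalkRegular : ℕ → Set
  WalkRegular r =
    DiameterAtLeast r ×
    (∀ (ℓ d : ℕ) (x y x' y' : Fin n) → d ≤ r → Dist x y d → Dist x' y' d →
       walks ℓ x y ≡ walks ℓ x' y')

  record Cycle (m : ℕ) : Set where
    field
      long   : 3 ≤ m
      v      : ℕ → Fin n
      closed : v m ≡ v 0
      edges  : ∀ i → i < m → Adj (v i) (v (suc i))
      inj    : ∀ i j → i < m → j < m → v i ≡ v j → i ≡ j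

  Odd : ℕ → Set
  Odd m = ∃ λ j → m ≡ suc (2 * j)

  OddGirth : ℕ → Set
  OddGirth g = Odd g × Cycle g × (∀ m → Odd m → Cycle m → g ≤ m)

  CompleteMultipartite : Set
  CompleteMultipartite =
    Σ (Fin n → ℕ) λ c → ∀ x y → Adj x y ⇔ (c x ≢ c y)

  adj2 : Fin n → Fin n → Bool
  adj2 x y = not (does (x F.≟ y)) ∧ (not (adj x y) ∧ any (λ z → adj x z ∧ adj z y) (allFin n))

  private
    anyCong : (p q : Fin n → Bool) → (∀ z → p z ≡ q z) → (xs : List (Fin n)) → any p xs ≡ any q xs
    anyCong p q e [] = refl
    anyCong p q e (z ∷ xs) = cong₂ _∨_ (e z) (anyCong p q e xs)

    eqSym : ∀ (x y : Fin n) → does (x F.≟ y) ≡ does (y F.≟ x)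
    eqSym x y with x F.≟ y | y F.≟ x
    ... | yes _ | yes _ = refl
    ... | no _  | no _  = refl
    ... | yes p | no q  = ⊥-elim (q (≡-sym p))
    ... | no p  | yes q = ⊥-elim (p (≡-sym q))

    eqRefl : ∀ (x : Fin n) → does (x F.≟ x) ≡ true
    eqRefl x with x F.≟ x
    ... | yes _ = refl
    ... | no p = ⊥-elim (p refl)

  adj2-sym : ∀ x y → adj2 x y ≡ adj2 y x
  adj2-sym x y = cong₂ (λ a b → not a ∧ b) (eqSym x y)
    (cong₂ (λ a b → not a ∧ b) (sym x y)
      (anyCong _ _ (λ z → trans (cong₂ _∧_ (sym x z) (sym z y)) (∧-comm (adj z x) (adj y z))) (allFin n)))

  adj2-irrefl : ∀ x → adj2 x x ≡ false
  adj2-irrefl x = cong (λ a → not a ∧ (not (adj x x) ∧ any (λ z → adj x z ∧ adj z x) (allFin n))) (eqRefl x)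

Distance2Graph : Graph → Graph
Distance2Graph G = record
  { n = Graph.n G ; adj = adj2 G ; sym = adj2-sym G ; irrefl = adj2-irrefl G }

module Submission where

-- Let A and A₂ be the adjacency matrices of Γ and Γ₂, so that walks of length ℓ are counted by
-- A^ℓ. Since t ≥ 2, two adjacent vertices have λ common neighbours and two vertices at distance 2
-- have μ > 0 of them, for constants λ and μ; hence A² = μA₂ + λA + kI, and μ^ℓ A₂^ℓ lies in the
-- ℤ-span of the powers of A. Its (x, y)-entry, and with it the number of ℓ-walks from x to y in Γ₂,
-- is therefore determined by the walk counts from x to y in Γ.
-- If x and y are at distance d in Γ₂ and 2d ≤ s, they are at distance 2d in Γ: a shorter even walk
-- halves to a shorter walk in Γ₂, while a shorter odd walk together with a walk of length 2d closes
-- an odd walk of length below 2s + 1, which contains an odd cycle shorter than the odd girth. When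
-- moreover 2d ≤ t, the t-walk-regularity of Γ makes the walk counts of such pairs agree.

open import Defs
open import Data.Nat using (ℕ; zero; suc)

module IntegerMatrix (n : ℕ) where

  open import Data.Bool using (Bool; if_then_else_)
  open import Data.Fin using (Fin; zero; suc; _≟_)
  open import Data.Integer using (ℤ; +_; _+_; _*_)
  open import Data.Integer.Properties
    using ( +-*-semiring; *-commutativeSemigroup; +-identityˡ; +-identityʳ; *-identityˡ; *-identityʳ
          ; *-zeroʳ; *-distribˡ-+; *-distribʳ-+; *-assoc)
  open import Algebra.Properties.Semiring.Sum +-*-semiring
    using (sum-syntax; sum-cong-≗; ∑-distrib-+; ∑-comm; *-distribˡ-sum; *-distribʳ-sum; sum-replicate-zero)
  open import Algebra.Properties.CommutativeSemigroup *-commutativeSemigroup using (x∙yz≈y∙xz)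
  open import Relation.Nullary using (does)
  open import Relation.Binary.PropositionalEquality

  ⟦_⟧ : Bool → ℤ
  ⟦ b ⟧ = + (if b then 1 else 0)

  ∑-select : ∀ {m} (x : Fin m) (f : Fin m → ℤ) → ∑[ z < m ] (⟦ does (x ≟ z) ⟧ * f z) ≡ f x
  ∑-select {suc m} zero    f =
    trans (cong₂ _+_ (*-identityˡ (f zero)) (sum-replicate-zero m)) (+-identityʳ (f zero))
  ∑-select {suc m} (suc x) f = trans (+-identityˡ _) (∑-select x (λ z → f (suc z)))

  ∑-selectʳ : ∀ {m} (x : Fin m) (f : Fin m → ℤ) → ∑[ z < m ] (f z * ⟦ does (z ≟ x) ⟧) ≡ f x
  ∑-selectʳ {suc m} zero    f = trans (cong₂ _+_ (*-identityʳ (f zero)) sum-of-zeros) (+-identityʳ (f zero))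
    where
    sum-of-zeros : ∑[ z < m ] (f (suc z) * ⟦ does (suc z ≟ zero) ⟧) ≡ + 0
    sum-of-zeros = trans (sum-cong-≗ (λ z → *-zeroʳ (f (suc z)))) (sum-replicate-zero m)
  ∑-selectʳ {suc m} (suc x) f =
    trans (cong₂ _+_ (*-zeroʳ (f zero)) (∑-selectʳ x (λ z → f (suc z)))) (+-identityˡ (f (suc x)))

  Matrix : Set
  Matrix = Fin n → Fin n → ℤ

  infix  4 _≈_
  infixl 6 _⊕_
  infixl 7 _⊙_ _⊗_
  infixr 8 _^_

  _≈_ : Matrix → Matrix → Set
  F ≈ H = ∀ x y → F x y ≡ H x y

  I : Matrix
  I x y = ⟦ does (x ≟ y) ⟧

  _⊕_ : Matrix → Matrix → Matrix
  (F ⊕ H) x y = F x y + H x y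

  _⊙_ : ℤ → Matrix → Matrix
  (c ⊙ F) x y = c * F x y

  _⊗_ : Matrix → Matrix → Matrix
  (F ⊗ H) x y = ∑[ z < n ] (F x z * H z y)

  _^_ : Matrix → ℕ → Matrix
  B ^ zero  = I
  B ^ suc ℓ = B ⊗ B ^ ℓ

  ≈-sym : ∀ {F H} → F ≈ H → H ≈ F
  ≈-sym e x y = sym (e x y)

  ≈-trans : ∀ {F H M} → F ≈ H → H ≈ M → F ≈ M
  ≈-trans e e′ x y = trans (e x y) (e′ x y)

  ⊗-congˡ : ∀ F {H H′} → H ≈ H′ → F ⊗ H ≈ F ⊗ H′
  ⊗-congˡ F e x y = sum-cong-≗ (λ z → cong (F x z *_) (e z y))

  ⊗-congʳ : ∀ H {F F′} → F ≈ F′ → F ⊗ H ≈ F′ ⊗ H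
  ⊗-congʳ H e x y = sum-cong-≗ (λ z → cong (_* H z y) (e x z))

  ⊗-identityˡ : ∀ F → I ⊗ F ≈ F
  ⊗-identityˡ F x y = ∑-select x (λ z → F z y)

  ⊗-identityʳ : ∀ F → F ⊗ I ≈ F
  ⊗-identityʳ F x y = ∑-selectʳ y (F x)

  ⊗-assoc : ∀ F H M → (F ⊗ H) ⊗ M ≈ F ⊗ (H ⊗ M)
  ⊗-assoc F H M x y = begin
    ∑[ w < n ] (∑[ z < n ] (F x z * H z w) * M w y)
      ≡⟨ sum-cong-≗ (λ w → *-distribʳ-sum (M w y) (λ z → F x z * H z w)) ⟩
    ∑[ w < n ] ∑[ z < n ] (F x z * H z w * M w y)
      ≡⟨ ∑-comm (λ w z → F x z * H z w * M w y) ⟩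
    ∑[ z < n ] ∑[ w < n ] (F x z * H z w * M w y)
      ≡⟨ sum-cong-≗ (λ z → sum-cong-≗ (λ w → *-assoc (F x z) (H z w) (M w y))) ⟩
    ∑[ z < n ] ∑[ w < n ] (F x z * (H z w * M w y))
      ≡⟨ sum-cong-≗ (λ z → sym (*-distribˡ-sum (F x z) (λ w → H z w * M w y))) ⟩
    ∑[ z < n ] (F x z * ∑[ w < n ] (H z w * M w y))
      ∎
    where open ≡-Reasoning

  ⊗-distribˡ-⊕ : ∀ F H M → F ⊗ (H ⊕ M) ≈ F ⊗ H ⊕ F ⊗ M
  ⊗-distribˡ-⊕ F H M x y =
    trans (sum-cong-≗ (λ z → *-distribˡ-+ (F x z) (H z y) (M z y)))
          (∑-distrib-+ (λ z → F x z * H z y) (λ z → F x z * M z y))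

  ⊗-distribʳ-⊕ : ∀ F H M → (F ⊕ H) ⊗ M ≈ F ⊗ M ⊕ H ⊗ M
  ⊗-distribʳ-⊕ F H M x y =
    trans (sum-cong-≗ (λ z → *-distribʳ-+ (M z y) (F x z) (H x z)))
          (∑-distrib-+ (λ z → F x z * M z y) (λ z → H x z * M z y))

  ⊙-⊗ : ∀ c F H → c ⊙ F ⊗ H ≈ c ⊙ (F ⊗ H)
  ⊙-⊗ c F H x y =
    trans (sum-cong-≗ (λ z → *-assoc c (F x z) (H z y))) (sym (*-distribˡ-sum c (λ z → F x z * H z y)))

  ⊗-⊙ : ∀ c F H → F ⊗ (c ⊙ H) ≈ c ⊙ (F ⊗ H)
  ⊗-⊙ c F H x y =
    trans (sum-cong-≗ (λ z → x∙yz≈y∙xz (F x z) c (H z y))) (sym (*-distribˡ-sum c (λ z → F x z * H z y)))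

module WalkMatrices (G : Graph) where

  open Graph G using (n; adj)
  open IntegerMatrix n

  import Data.Nat as ℕ
  import Data.Nat.ListAction as ℕ
  open import Data.Bool using (true; false; if_then_else_)
  open import Data.Fin using (Fin; zero; suc)
  open import Data.List using (map; allFin; tabulate)
  open import Data.List.Properties using (map-tabulate)
  open import Data.Integer using (+_; _+_; _*_)
  open import Data.Integer.Properties using (+-*-semiring; pos-+; pos-*; +-injective; *-identityˡ; *-assoc)
  open import Algebra.Properties.Semiring.Sum +-*-semiring using (sum-syntax; sum-cong-≗)
  open import Relation.Binary.PropositionalEquality

  +-sum-tabulate : ∀ {m} (f : Fin m → ℕ.ℕ) → + ℕ.sum (tabulate f) ≡ ∑[ z < m ] (+ f z)
  +-sum-tabulate {ℕ.zero}  f = refl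
  +-sum-tabulate {ℕ.suc m} f =
    trans (pos-+ (f zero) _) (cong (λ s → + f zero + s) (+-sum-tabulate (λ z → f (suc z))))

  +-if : ∀ b m → + (if b then m else 0) ≡ ⟦ b ⟧ * + m
  +-if true  m = sym (*-identityˡ (+ m))
  +-if false m = refl

  adjacencyMatrix : Matrix
  adjacencyMatrix x y = ⟦ adj x y ⟧

  walkMatrix : ℕ.ℕ → Matrix
  walkMatrix ℓ x y = + walks G ℓ x y

  walkMatrix-suc : ∀ ℓ → walkMatrix (ℕ.suc ℓ) ≈ adjacencyMatrix ⊗ walkMatrix ℓ
  walkMatrix-suc ℓ x y = begin
    + ℕ.sum (map term (allFin n))  ≡⟨ cong (λ zs → + ℕ.sum zs) (map-tabulate (λ z → z) term) ⟩
    + ℕ.sum (tabulate term)        ≡⟨ +-sum-tabulate term ⟩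
    ∑[ z < n ] (+ term z)          ≡⟨ sum-cong-≗ (λ z → +-if (adj x z) (walks G ℓ z y)) ⟩
    ∑[ z < n ] (⟦ adj x z ⟧ * + walks G ℓ z y) ∎
    where
    open ≡-Reasoning
    term : Fin n → ℕ.ℕ
    term z = if adj x z then walks G ℓ z y else 0

  walkMatrix-power : ∀ ℓ → walkMatrix ℓ ≈ adjacencyMatrix ^ ℓ
  walkMatrix-power ℕ.zero    x y = refl
  walkMatrix-power (ℕ.suc ℓ) = ≈-trans (walkMatrix-suc ℓ) (⊗-congˡ adjacencyMatrix (walkMatrix-power ℓ))

  walkMatrix-one : walkMatrix 1 ≈ adjacencyMatrix
  walkMatrix-one = ≈-trans (walkMatrix-suc 0) (⊗-identityʳ adjacencyMatrix)

  walks-one : ∀ x y → walks G 1 x y ≡ (if adj x y then 1 else 0)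
  walks-one x y = +-injective (walkMatrix-one x y)

  data InAdjacencyAlgebra : Matrix → Set where
    walkMatrix∈ : ∀ ℓ → InAdjacencyAlgebra (walkMatrix ℓ)
    ⊕-closed    : ∀ {F H} → InAdjacencyAlgebra F → InAdjacencyAlgebra H → InAdjacencyAlgebra (F ⊕ H)
    ⊙-closed    : ∀ c {F} → InAdjacencyAlgebra F → InAdjacencyAlgebra (c ⊙ F)
    ≈-closed    : ∀ {F H} → F ≈ H → InAdjacencyAlgebra F → InAdjacencyAlgebra H

  SameWalkCounts : Fin n → Fin n → Fin n → Fin n → Set
  SameWalkCounts x y x′ y′ = ∀ ℓ → walks G ℓ x y ≡ walks G ℓ x′ y′

  inAdjacencyAlgebra-respects-walkCounts : ∀ {F x y x′ y′} → InAdjacencyAlgebra F →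
    SameWalkCounts x y x′ y′ → F x y ≡ F x′ y′
  inAdjacencyAlgebra-respects-walkCounts (walkMatrix∈ ℓ) same = cong +_ (same ℓ)
  inAdjacencyAlgebra-respects-walkCounts (⊕-closed P Q) same =
    cong₂ _+_ (inAdjacencyAlgebra-respects-walkCounts P same) (inAdjacencyAlgebra-respects-walkCounts Q same)
  inAdjacencyAlgebra-respects-walkCounts (⊙-closed c P) same =
    cong (c *_) (inAdjacencyAlgebra-respects-walkCounts P same)
  inAdjacencyAlgebra-respects-walkCounts {x = x} {y} {x′} {y′} (≈-closed e P) same =
    trans (sym (e x y)) (trans (inAdjacencyAlgebra-respects-walkCounts P same) (e x′ y′))

  adjacency⊗-closed : ∀ {F} → InAdjacencyAlgebra F → InAdjacencyAlgebra (adjacencyMatrix ⊗ F)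
  adjacency⊗-closed (walkMatrix∈ ℓ) = ≈-closed (walkMatrix-suc ℓ) (walkMatrix∈ (ℕ.suc ℓ))
  adjacency⊗-closed (⊕-closed {F} {H} P Q) =
    ≈-closed (≈-sym (⊗-distribˡ-⊕ adjacencyMatrix F H)) (⊕-closed (adjacency⊗-closed P) (adjacency⊗-closed Q))
  adjacency⊗-closed (⊙-closed c {F} P) =
    ≈-closed (≈-sym (⊗-⊙ c adjacencyMatrix F)) (⊙-closed c (adjacency⊗-closed P))
  adjacency⊗-closed (≈-closed e P) = ≈-closed (⊗-congˡ adjacencyMatrix e) (adjacency⊗-closed P)

  walkMatrix⊗-closed : ∀ ℓ {F} → InAdjacencyAlgebra F → InAdjacencyAlgebra (walkMatrix ℓ ⊗ F)
  walkMatrix⊗-closed ℕ.zero    {F} P = ≈-closed (≈-sym (⊗-identityˡ F)) P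
  walkMatrix⊗-closed (ℕ.suc ℓ) {F} P = ≈-closed
    (≈-trans (≈-sym (⊗-assoc adjacencyMatrix (walkMatrix ℓ) F)) (⊗-congʳ F (≈-sym (walkMatrix-suc ℓ))))
    (adjacency⊗-closed (walkMatrix⊗-closed ℓ P))

  ⊗-closed : ∀ {F H} → InAdjacencyAlgebra F → InAdjacencyAlgebra H → InAdjacencyAlgebra (F ⊗ H)
  ⊗-closed (walkMatrix∈ ℓ) Q = walkMatrix⊗-closed ℓ Q
  ⊗-closed {H = M} (⊕-closed {F} {H} P P′) Q =
    ≈-closed (≈-sym (⊗-distribʳ-⊕ F H M)) (⊕-closed (⊗-closed P Q) (⊗-closed P′ Q))
  ⊗-closed {H = M} (⊙-closed c {F} P) Q = ≈-closed (≈-sym (⊙-⊗ c F M)) (⊙-closed c (⊗-closed P Q))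
  ⊗-closed {H = M} (≈-closed e P) Q = ≈-closed (⊗-congʳ M e) (⊗-closed P Q)

  scaledPower-closed : ∀ (c : ℕ.ℕ) B → InAdjacencyAlgebra (+ c ⊙ B) →
    ∀ ℓ → InAdjacencyAlgebra (+ (c ℕ.^ ℓ) ⊙ B ^ ℓ)
  scaledPower-closed c B P ℕ.zero    = ≈-closed (λ x y → sym (*-identityˡ (I x y))) (walkMatrix∈ 0)
  scaledPower-closed c B P (ℕ.suc ℓ) = ≈-closed product (⊗-closed P (scaledPower-closed c B P ℓ))
    where
    product : (+ c ⊙ B) ⊗ (+ (c ℕ.^ ℓ) ⊙ B ^ ℓ) ≈ + (c ℕ.^ ℕ.suc ℓ) ⊙ B ^ ℕ.suc ℓ
    product x y = begin
      ((+ c ⊙ B) ⊗ (+ (c ℕ.^ ℓ) ⊙ B ^ ℓ)) x y       ≡⟨ ⊙-⊗ (+ c) B (+ (c ℕ.^ ℓ) ⊙ B ^ ℓ) x y ⟩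
      + c * (B ⊗ (+ (c ℕ.^ ℓ) ⊙ B ^ ℓ)) x y       ≡⟨ cong (+ c *_) (⊗-⊙ (+ (c ℕ.^ ℓ)) B (B ^ ℓ) x y) ⟩
      + c * (+ (c ℕ.^ ℓ) * (B ⊗ B ^ ℓ) x y)     ≡⟨ sym (*-assoc (+ c) _ _) ⟩
      + c * + (c ℕ.^ ℓ) * (B ⊗ B ^ ℓ) x y       ≡⟨ cong (_* (B ⊗ B ^ ℓ) x y) (sym (pos-* c _)) ⟩
      + (c ℕ.^ ℕ.suc ℓ) * (B ⊗ B ^ ℓ) x y       ∎
      where open ≡-Reasoning

module Distance2WalkCounts (G : Graph) where

  open Graph G using (n)
  open IntegerMatrix n
  open WalkMatrices G
  private module G₂ = WalkMatrices (Distance2Graph G)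

  import Data.Nat as ℕ
  open import Data.Nat.Properties using (m^n≢0; *-cancelˡ-≡)
  open import Data.Integer using (+_; -_; _+_; _*_)
  open import Data.Integer.Properties using (pos-+; pos-*; +-injective)
  open import Data.Integer.Tactic.RingSolver using (solve-∀)
  open import Relation.Binary.PropositionalEquality

  module _ (μ λ′ k : ℕ.ℕ) .{{_ : ℕ.NonZero μ}}
    (square : ∀ x z → walks G 2 x z ≡
                      μ ℕ.* walks (Distance2Graph G) 1 x z ℕ.+ λ′ ℕ.* walks G 1 x z ℕ.+ k ℕ.* walks G 0 x z)
    where

    private
      pos-linear : ∀ m a l b k c → + (m ℕ.* a ℕ.+ l ℕ.* b ℕ.+ k ℕ.* c) ≡ + m * + a + + l * + b + + k * + c
      pos-linear m a l b k c =
        trans (pos-+ _ (k ℕ.* c)) (cong₂ _+_ (trans (pos-+ (m ℕ.* a) _) (cong₂ _+_ (pos-* m a) (pos-* l b))) (pos-* k c))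

      isolate : ∀ a b c m l k w → w ≡ m * a + l * b + k * c → w + - l * b + - k * c ≡ m * a
      isolate a b c m l k w refl = arithmetic a b c m l k
        where
        arithmetic : ∀ a b c m l k → m * a + l * b + k * c + - l * b + - k * c ≡ m * a
        arithmetic = solve-∀

    μA₂-inAdjacencyAlgebra : InAdjacencyAlgebra (+ μ ⊙ G₂.adjacencyMatrix)
    μA₂-inAdjacencyAlgebra = ≈-closed rearranged
      (⊕-closed (⊕-closed (walkMatrix∈ 2) (⊙-closed (- + λ′) (walkMatrix∈ 1))) (⊙-closed (- + k) (walkMatrix∈ 0)))
      where
      rearranged : walkMatrix 2 ⊕ (- + λ′) ⊙ walkMatrix 1 ⊕ (- + k) ⊙ walkMatrix 0 ≈ + μ ⊙ G₂.adjacencyMatrix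
      rearranged x z = trans
        (isolate (G₂.walkMatrix 1 x z) _ _ (+ μ) (+ λ′) (+ k) _ (trans (cong +_ (square x z)) (pos-linear μ _ λ′ _ k _)))
        (cong (+ μ *_) (G₂.walkMatrix-one x z))

    distance2Walks-respect-walkCounts : ∀ {x y x′ y′} → SameWalkCounts x y x′ y′ →
      ∀ ℓ → walks (Distance2Graph G) ℓ x y ≡ walks (Distance2Graph G) ℓ x′ y′
    distance2Walks-respect-walkCounts {x} {y} {x′} {y′} same ℓ =
      *-cancelˡ-≡ _ _ (μ ℕ.^ ℓ) {{m^n≢0 μ ℓ}} (+-injective (begin
        + (μ ℕ.^ ℓ ℕ.* walks (Distance2Graph G) ℓ x y)    ≡⟨ scaled x y ⟩
        (+ (μ ℕ.^ ℓ) ⊙ G₂.adjacencyMatrix ^ ℓ) x y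
          ≡⟨ inAdjacencyAlgebra-respects-walkCounts (scaledPower-closed μ _ μA₂-inAdjacencyAlgebra ℓ) same ⟩
        (+ (μ ℕ.^ ℓ) ⊙ G₂.adjacencyMatrix ^ ℓ) x′ y′     ≡⟨ scaled x′ y′ ⟨
        + (μ ℕ.^ ℓ ℕ.* walks (Distance2Graph G) ℓ x′ y′) ∎))
      where
      open ≡-Reasoning
      scaled : ∀ u v →
        + (μ ℕ.^ ℓ ℕ.* walks (Distance2Graph G) ℓ u v) ≡ (+ (μ ℕ.^ ℓ) ⊙ G₂.adjacencyMatrix ^ ℓ) u v
      scaled u v = trans (pos-* (μ ℕ.^ ℓ) _) (cong (+ (μ ℕ.^ ℓ) *_) (G₂.walkMatrix-power ℓ u v))

open import Data.Nat using (_≤_; _<_; _⊓_; _/_; _*_; _+_; _∸_; z≤n; s≤s; NonZero; >-nonZero)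
open import Data.Nat.Properties
open import Data.Nat.Induction using (<-rec)
open import Data.Nat.DivMod using (m/n*n≤m)
open import Data.Nat.ListAction using (sum)
open import Data.Nat.Tactic.RingSolver using (solve-∀)
open import Data.Bool using (Bool; true; false; if_then_else_; _∧_)
open import Data.Bool.Properties using (T-≡)
open import Data.Bool.ListAction using (any)
open import Data.Fin using (Fin)
import Data.Fin as F
open import Data.Fin.Properties using (any?)
open import Data.List using ([]; _∷_; map; allFin)
open import Data.List.Properties using (map-cong)
open import Data.List.Membership.Propositional using (_∈_)
open import Data.List.Membership.Propositional.Properties using (∈-allFin)
import Data.List.Relation.Unary.Any as Any
open import Data.List.Relation.Unary.Any.Properties using (any⁺; any⁻)
open import Data.Product using (∃; ∃₂; _×_; _,_; proj₁; proj₂; map₂)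
open import Data.Sum using (_⊎_; inj₁; inj₂)
open import Function.Bundles using (Equivalence)
open import Relation.Nullary using (¬_; Dec; yes; no; contradiction)
open import Relation.Nullary.Decidable using (map′; _×-dec_)
open import Relation.Unary using (Decidable)
open import Relation.Binary using (tri<; tri≈; tri>)
open import Relation.Binary.PropositionalEquality

Least : ∀ {p} → (ℕ → Set p) → ℕ → Set p
Least P d = P d × (∀ j → j < d → ¬ P j)

least-witness : ∀ {p} {P : ℕ → Set p} → Decidable P → ∀ {ℓ} → P ℓ → ∃ λ d → d ≤ ℓ × Least P d
least-witness {P = P} P? {ℓ} = <-rec (λ ℓ → P ℓ → ∃ λ d → d ≤ ℓ × Least P d) least ℓ
  where
  least : ∀ ℓ → (∀ {j} → j < ℓ → P j → ∃ λ d → d ≤ j × Least P d) → P ℓ → ∃ λ d → d ≤ ℓ × Least P d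
  least ℓ smaller pℓ with anyUpTo? P? ℓ
  ... | no none = ℓ , ≤-refl , pℓ , λ j j<ℓ pj → none (j , j<ℓ , pj)
  ... | yes (j , j<ℓ , pj) with smaller j<ℓ pj
  ...   | d , d≤j , least-d = d , ≤-trans d≤j (<⇒≤ j<ℓ) , least-d

sum-map-≤ : ∀ {A : Set} (f : A → ℕ) {z xs} → z ∈ xs → f z ≤ sum (map f xs)
sum-map-≤ f (Any.here refl) = m≤m+n _ _
sum-map-≤ f {xs = y ∷ _} (Any.there z∈xs) = ≤-trans (sum-map-≤ f z∈xs) (m≤n+m _ (f y))

sum-map-zero : ∀ {A : Set} (f : A → ℕ) → (∀ z → f z ≡ 0) → ∀ xs → sum (map f xs) ≡ 0
sum-map-zero f f≡0 [] = refl
sum-map-zero f f≡0 (y ∷ xs) = cong₂ _+_ (f≡0 y) (sum-map-zero f f≡0 xs)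

m≤n/2⇒2*m≤n : ∀ {m} n → m ≤ n / 2 → 2 * m ≤ n
m≤n/2⇒2*m≤n n m≤n/2 = ≤-trans (*-monoʳ-≤ 2 m≤n/2) (≤-trans (≤-reflexive (*-comm 2 (n / 2))) (m/n*n≤m n 2))

rotate : ∀ i p q → p + (q + i) ≡ i + (p + q)
rotate = solve-∀

∧≡true⁻ : ∀ {a b} → a ∧ b ≡ true → a ≡ true × b ≡ true
∧≡true⁻ {true} {true} _ = refl , refl

any-allFin⁺ : ∀ {m} (p : Fin m → Bool) z → p z ≡ true → any p (allFin m) ≡ true
any-allFin⁺ p z pz = Equivalence.to T-≡ (any⁺ p (Any.map (λ { refl → Equivalence.from T-≡ pz }) (∈-allFin z)))

any-allFin⁻ : ∀ {m} (p : Fin m → Bool) → any p (allFin m) ≡ true → ∃ λ z → p z ≡ true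
any-allFin⁻ {m} p e = map₂ (Equivalence.to T-≡) (Any.satisfied (any⁻ p (allFin m) (Equivalence.from T-≡ e)))

module Parity (G : Graph) where

  Even : ℕ → Set
  Even m = ∃ λ e → m ≡ 2 * e

  even⊎odd : ∀ m → Even m ⊎ Odd G m
  even⊎odd zero = inj₁ (0 , refl)
  even⊎odd (suc m) with even⊎odd m
  ... | inj₁ (e , refl) = inj₂ (e , refl)
  ... | inj₂ (j , refl) = inj₁ (suc j , sym (*-suc 2 j))

  odd-+ : ∀ a b → Odd G (a + b) → Odd G a ⊎ Odd G b
  odd-+ a b (j , a+b≡) with even⊎odd a | even⊎odd b
  ... | inj₂ odd-a | _ = inj₁ odd-a
  ... | inj₁ _ | inj₂ odd-b = inj₂ odd-b
  ... | inj₁ (e , refl) | inj₁ (f , refl) =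
    contradiction (trans (*-distribˡ-+ 2 e f) a+b≡) (even≢odd (e + f) j)

  even+odd : ∀ e b → Odd G b → Odd G (2 * e + b)
  even+odd e b (j , refl) = e + j , (begin
    2 * e + suc (2 * j)    ≡⟨ +-suc (2 * e) (2 * j) ⟩
    suc (2 * e + 2 * j)    ≡⟨ cong suc (*-distribˡ-+ 2 e j) ⟨
    suc (2 * (e + j))      ∎)
    where open ≡-Reasoning

module WalkProperties (G : Graph) where

  open Graph G using (n; adj) renaming (sym to adj-sym; irrefl to adj-irrefl)
  open Parity G using (odd-+)

  walk-zero⇒≡ : ∀ {x y} → Walk G 0 x y → x ≡ y
  walk-zero⇒≡ here = refl

  no-loop : ∀ {x} → ¬ Walk G 1 x x
  no-loop {x} (step x~x here) with trans (sym x~x) (adj-irrefl x)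
  ... | ()

  infixr 5 _++ʷ_

  _++ʷ_ : ∀ {a b x m y} → Walk G a x m → Walk G b m y → Walk G (a + b) x y
  here       ++ʷ w′ = w′
  step e w   ++ʷ w′ = step e (w ++ʷ w′)

  splitWalk : ∀ a {b x y} → Walk G (a + b) x y → ∃ λ m → Walk G a x m × Walk G b m y
  splitWalk zero    w          = _ , here , w
  splitWalk (suc a) (step e w) with splitWalk a w
  ... | m , w₁ , w₂ = m , step e w₁ , w₂

  adj-symmetric : ∀ {x y} → Adj G x y → Adj G y x
  adj-symmetric {x} {y} = trans (adj-sym y x)

  snoc : ∀ {ℓ x m y} → Walk G ℓ x m → Adj G m y → Walk G (suc ℓ) x y
  snoc here       e = step e here
  snoc (step e′ w) e = step e′ (snoc w e)

  reverseWalk : ∀ {ℓ x y} → Walk G ℓ x y → Walk G ℓ y x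
  reverseWalk here       = here
  reverseWalk (step e w) = snoc (reverseWalk w) (adj-symmetric e)

  walk? : ∀ ℓ x y → Dec (Walk G ℓ x y)
  walk? zero    x y = map′ (λ { refl → here }) walk-zero⇒≡ (x F.≟ y)
  walk? (suc ℓ) x y = map′ (λ { (z , e , w) → step e w }) (λ { (step e w) → _ , e , w })
    (any? (λ z → (adj x z Data.Bool.≟ true) ×-dec walk? ℓ z y))

  walk⇒dist : ∀ {ℓ x y} → Walk G ℓ x y → ∃ λ d → d ≤ ℓ × Dist G x y d
  walk⇒dist {x = x} {y} = least-witness (λ j → walk? j x y)

  dist-split : ∀ a b {x y} → Dist G x y (a + b) → ∃ λ m → Dist G x m a × Dist G m y b
  dist-split a b (w , shortest) with splitWalk a w
  ... | m , w₁ , w₂ =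
    m , (w₁ , λ ℓ ℓ<a w → shortest (ℓ + b) (+-monoˡ-< b ℓ<a) (w ++ʷ w₂))
      , (w₂ , λ ℓ ℓ<b w → shortest (a + ℓ) (+-monoʳ-< a ℓ<b) (w₁ ++ʷ w))

  diameter⇒pairAtDistance : ∀ {r t} → r ≤ t → Connected G → DiameterAtLeast G t → ∃₂ λ x y → Dist G x y r
  diameter⇒pairAtDistance {r} r≤t connected (x , y , far) with walk⇒dist (proj₂ (connected x y))
  ... | D , _ , geodesic with r ≤? D
  ...   | no D≱r  = contradiction (proj₁ geodesic) (far D (<-≤-trans (≰⇒> D≱r) r≤t))
  ...   | yes r≤D with m≤n⇒∃[o]m+o≡n r≤D
  ...     | b , refl with dist-split r b geodesic
  ...       | z , x-z , _ = x , z , x-z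

  adj⇒dist1 : ∀ {x y} → Adj G x y → Dist G x y 1
  adj⇒dist1 {x} e = step e here , λ
    { zero    _           w → no-loop (subst (Walk G 1 x) (sym (walk-zero⇒≡ w)) (step e here))
    ; (suc _) (s≤s ()) _ }

  walks-zero-self : ∀ x → walks G 0 x x ≡ 1
  walks-zero-self x with x F.≟ x
  ... | yes _  = refl
  ... | no x≢x = contradiction refl x≢x

  walks-zero-≢ : ∀ {x y} → x ≢ y → walks G 0 x y ≡ 0
  walks-zero-≢ {x} {y} x≢y with x F.≟ y
  ... | yes x≡y = contradiction x≡y x≢y
  ... | no _    = refl

  walk⇒walks-pos : ∀ {ℓ x y} → Walk G ℓ x y → 1 ≤ walks G ℓ x y
  walk⇒walks-pos {x = x} here = ≤-reflexive (sym (walks-zero-self x))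
  walk⇒walks-pos {suc ℓ} {x} {y} (step {z = z} e w) = begin
    1                                         ≤⟨ walk⇒walks-pos w ⟩
    walks G ℓ z y                             ≡⟨ cong (λ b → if b then walks G ℓ z y else 0) e ⟨
    (if adj x z then walks G ℓ z y else 0)    ≤⟨ sum-map-≤ (λ z → if adj x z then walks G ℓ z y else 0) (∈-allFin z) ⟩
    walks G (suc ℓ) x y                       ∎
    where open ≤-Reasoning

  ¬walk⇒walks≡0 : ∀ {ℓ x y} → ¬ Walk G ℓ x y → walks G ℓ x y ≡ 0
  ¬walk⇒walks≡0 {zero} {x} {y} no-walk with x F.≟ y
  ... | yes refl = contradiction here no-walk
  ... | no _     = refl
  ¬walk⇒walks≡0 {suc ℓ} {x} {y} no-walk = sum-map-zero _ term≡0 (allFin n)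
    where
    term≡0 : ∀ z → (if adj x z then walks G ℓ z y else 0) ≡ 0
    term≡0 z with adj x z in e
    ... | true  = ¬walk⇒walks≡0 (λ w → no-walk (step e w))
    ... | false = refl

  vertexAt : ∀ {ℓ x y} → Walk G ℓ x y → ℕ → Fin n
  vertexAt {x = x} here       _       = x
  vertexAt {x = x} (step _ _) zero    = x
  vertexAt         (step _ w) (suc i) = vertexAt w i

  vertexAt-start : ∀ {ℓ x y} (w : Walk G ℓ x y) → vertexAt w 0 ≡ x
  vertexAt-start here       = refl
  vertexAt-start (step _ _) = refl

  vertexAt-end : ∀ {ℓ x y} (w : Walk G ℓ x y) → vertexAt w ℓ ≡ y
  vertexAt-end here       = refl
  vertexAt-end (step _ w) = vertexAt-end w

  vertexAt-adj : ∀ {ℓ x y} (w : Walk G ℓ x y) → ∀ i → i < ℓ → Adj G (vertexAt w i) (vertexAt w (suc i))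
  vertexAt-adj (step e w) zero    _         = subst (Adj G _) (sym (vertexAt-start w)) e
  vertexAt-adj (step _ w) (suc i) (s≤s i<ℓ) = vertexAt-adj w i i<ℓ

  splitWalk-middle : ∀ a {b x y} (w : Walk G (a + b) x y) → proj₁ (splitWalk a w) ≡ vertexAt w a
  splitWalk-middle zero    w          = sym (vertexAt-start w)
  splitWalk-middle (suc a) (step e w) = splitWalk-middle a w

  splitWalk-suffix : ∀ a {b x y} (w : Walk G (a + b) x y) k →
    vertexAt (proj₂ (proj₂ (splitWalk a w))) k ≡ vertexAt w (a + k)
  splitWalk-suffix zero    w          k = refl
  splitWalk-suffix (suc a) (step e w) k = splitWalk-suffix a w k

  vertexAt-subst : ∀ {ℓ ℓ′ x y} (e : ℓ ≡ ℓ′) (w : Walk G ℓ x y) k →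
    vertexAt (subst (λ ℓ → Walk G ℓ x y) e w) k ≡ vertexAt w k
  vertexAt-subst refl w k = refl

  shortcut : ∀ i p q {x} (w : Walk G (i + (p + q)) x x) → vertexAt w i ≡ vertexAt w (i + p) →
    ∃ λ u → Walk G p u u × Walk G (q + i) u u
  shortcut i p q w same with splitWalk i w | splitWalk-middle i w | splitWalk-suffix i w
  ... | u , w₁ , w′ | u≡wᵢ | suffix with splitWalk p w′ | splitWalk-middle p w′
  ...   | v , loop , w₃ | v≡w′ₚ =
    u , subst (Walk G p u) (sym u≡v) loop , subst (λ z → Walk G (q + i) z u) (sym u≡v) (w₃ ++ʷ w₁)
    where
    u≡v : u ≡ v
    u≡v = trans u≡wᵢ (trans same (sym (trans v≡w′ₚ (suffix p))))

  OddClosedWalkBelow : ℕ → Set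
  OddClosedWalkBelow L = ∃ λ L′ → L′ < L × Odd G L′ × ∃ λ u → Walk G L′ u u

  oddShortcut : ∀ i p q {x} (w : Walk G (i + (p + q)) x x) → 0 < p → 0 < q →
    vertexAt w i ≡ vertexAt w (i + p) → Odd G (i + (p + q)) → OddClosedWalkBelow (i + (p + q))
  oddShortcut i p q w 0<p 0<q same odd
    with shortcut i p q w same | odd-+ p (q + i) (subst (Odd G) (sym (rotate i p q)) odd)
  ... | u , loop , _ | inj₁ odd-p =
    p , subst (p <_) (rotate i p q) (m<m+n p (<-≤-trans 0<q (m≤m+n q i))) , odd-p , u , loop
  ... | u , _ , loop | inj₂ odd-q+i =
    q + i , subst (q + i <_) (rotate i p q) (m<n+m (q + i) 0<p) , odd-q+i , u , loop

  Repeats : ∀ {ℓ x y} → Walk G ℓ x y → Set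
  Repeats {ℓ} w = ∃ λ j → j < ℓ × ∃ λ i → i < j × vertexAt w i ≡ vertexAt w j

  repeats? : ∀ {ℓ x y} (w : Walk G ℓ x y) → Dec (Repeats w)
  repeats? {ℓ} w = anyUpTo? (λ j → anyUpTo? (λ i → vertexAt w i F.≟ vertexAt w j) j) ℓ

  repeating⇒shorterOddClosedWalk : ∀ {L x} (w : Walk G L x x) → Repeats w → Odd G L → OddClosedWalkBelow L
  repeating⇒shorterOddClosedWalk {L} {x} w (j , j<L , i , i<j , same) odd =
    subst OddClosedWalkBelow L≡
      (oddShortcut i (j ∸ i) (L ∸ j) w′ (m<n⇒0<n∸m i<j) (m<n⇒0<n∸m j<L) same′ (subst (Odd G) (sym L≡) odd))
    where
    L≡ : i + ((j ∸ i) + (L ∸ j)) ≡ L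
    L≡ = trans (sym (+-assoc i (j ∸ i) (L ∸ j)))
               (trans (cong (_+ (L ∸ j)) (m+[n∸m]≡n (<⇒≤ i<j))) (m+[n∸m]≡n (<⇒≤ j<L)))
    w′ : Walk G (i + ((j ∸ i) + (L ∸ j))) x x
    w′ = subst (λ ℓ → Walk G ℓ x x) (sym L≡) w
    same′ : vertexAt w′ i ≡ vertexAt w′ (i + (j ∸ i))
    same′ = trans (vertexAt-subst (sym L≡) w i)
            (trans same (sym (trans (vertexAt-subst (sym L≡) w _) (cong (vertexAt w) (m+[n∸m]≡n (<⇒≤ i<j))))))

  nonrepeating⇒cycle : ∀ {L x} (w : Walk G L x x) → ¬ Repeats w → Odd G L → Cycle G L
  nonrepeating⇒cycle {L} w distinct odd = record
    { long   = long odd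
    ; v      = vertexAt w
    ; closed = trans (vertexAt-end w) (sym (vertexAt-start w))
    ; edges  = vertexAt-adj w
    ; inj    = injective
    }
    where
    long : Odd G L → 3 ≤ L
    long (zero  , refl) = contradiction w no-loop
    long (suc j , refl) = s≤s (*-monoʳ-≤ 2 (s≤s z≤n))
    injective : ∀ i j → i < L → j < L → vertexAt w i ≡ vertexAt w j → i ≡ j
    injective i j i<L j<L same with <-cmp i j
    ... | tri< i<j _ _ = contradiction (j , j<L , i , i<j , same) distinct
    ... | tri≈ _ i≡j _ = i≡j
    ... | tri> _ _ j<i = contradiction (i , i<L , j , j<i , sym same) distinct

  OddCycleWithin : ℕ → Set
  OddCycleWithin L = ∃ λ m → m ≤ L × Odd G m × Cycle G m

  oddClosedWalk⇒oddCycle : ∀ L {x} → Walk G L x x → Odd G L → OddCycleWithin L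
  oddClosedWalk⇒oddCycle = <-rec _ extract
    where
    extract : ∀ L → (∀ {L′} → L′ < L → ∀ {x} → Walk G L′ x x → Odd G L′ → OddCycleWithin L′) →
      ∀ {x} → Walk G L x x → Odd G L → OddCycleWithin L
    extract L shorter w odd with repeats? w
    ... | no distinct = L , ≤-refl , odd , nonrepeating⇒cycle w distinct odd
    ... | yes repeats with repeating⇒shorterOddClosedWalk w repeats odd
    ...   | L′ , L′<L , odd′ , _ , w′ with shorter L′<L w′ odd′
    ...     | m , m≤L′ , odd-m , cycle = m , ≤-trans m≤L′ (<⇒≤ L′<L) , odd-m , cycle

  oddGirth≤oddClosedWalk : ∀ {g L x} → OddGirth G g → Walk G L x x → Odd G L → g ≤ L
  oddGirth≤oddClosedWalk {L = L} (_ , _ , shortest) w odd with oddClosedWalk⇒oddCycle L w odd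
  ... | m , m≤L , odd-m , cycle = ≤-trans (shortest m odd-m cycle) m≤L

module DistanceTwo (G : Graph) where

  open Graph G using (adj)
  open WalkProperties G
  open Parity G

  G₂ : Graph
  G₂ = Distance2Graph G

  no-walk-below-2 : ∀ {x y} → x ≢ y → adj x y ≡ false → ∀ ℓ → ℓ < 2 → ¬ Walk G ℓ x y
  no-walk-below-2 x≢y _   zero    _                 w               = x≢y (walk-zero⇒≡ w)
  no-walk-below-2 _   x≁y (suc zero) _              (step x~y here) = contradiction (trans (sym x~y) x≁y) λ ()
  no-walk-below-2 _   _   (suc (suc _)) (s≤s (s≤s ())) _

  adj2⇒dist2 : ∀ {x y} → Adj G₂ x y → Dist G x y 2
  adj2⇒dist2 {x} {y} e with x F.≟ y | adj x y in xy
  adj2⇒dist2 () | yes _   | _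
  adj2⇒dist2 () | no _    | true
  ... | no x≢y | false with any-allFin⁻ (λ z → adj x z ∧ adj z y) e
  ...   | z , xzy with ∧≡true⁻ {adj x z} xzy
  ...     | x~z , z~y = step x~z (step z~y here) , no-walk-below-2 x≢y xy

  dist2⇒adj2 : ∀ {x y} → Dist G x y 2 → Adj G₂ x y
  dist2⇒adj2 {x} {y} (step {z = z} x~z (step z~y here) , shortest) with x F.≟ y | adj x y in xy
  ... | yes refl | _     = contradiction here (shortest 0 (s≤s z≤n))
  ... | no _     | true  = contradiction (step xy here) (shortest 1 (s≤s (s≤s z≤n)))
  ... | no _     | false = any-allFin⁺ (λ z → adj x z ∧ adj z y) z (cong₂ _∧_ x~z z~y)

  doubleWalk : ∀ {d x y} → Walk G₂ d x y → Walk G (2 * d) x y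
  doubleWalk here                 = here
  doubleWalk {suc d} {x} {y} (step x≈z w) =
    subst (λ ℓ → Walk G ℓ x y) (sym (*-suc 2 d)) (proj₁ (adj2⇒dist2 x≈z) ++ʷ doubleWalk w)

  halveGeodesic : ∀ d {x y} → Dist G x y (2 * d) → Walk G₂ d x y
  halveGeodesic zero    {x} (w , _) = subst (Walk G₂ 0 x) (walk-zero⇒≡ w) here
  halveGeodesic (suc d) {x} {y} D with dist-split 2 (2 * d) (subst (Dist G x y) (*-suc 2 d) D)
  ... | m , D₁ , D₂ = step (dist2⇒adj2 D₁) (halveGeodesic d D₂)

  dist₂⇒dist : ∀ {s d x y} → OddGirth G (2 * s + 1) → 2 * d ≤ s → Dist G₂ x y d → Dist G x y (2 * d)
  dist₂⇒dist {s} {d} {x} {y} oddGirth 2d≤s (w₂ , shortest₂) = doubleWalk w₂ , no-shorter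
    where
    no-shorter : ∀ ℓ → ℓ < 2 * d → ¬ Walk G ℓ x y
    no-shorter ℓ ℓ<2d w with walk⇒dist w
    ... | m , m≤ℓ , D@(geodesic , _) with even⊎odd m
    ...   | inj₁ (e , refl) = shortest₂ e (*-cancelˡ-< 2 e d (≤-<-trans m≤ℓ ℓ<2d)) (halveGeodesic e D)
    ...   | inj₂ odd-m =
      <⇒≱ too-short (oddGirth≤oddClosedWalk oddGirth (doubleWalk w₂ ++ʷ reverseWalk geodesic) (even+odd d m odd-m))
      where
      too-short : 2 * d + m < 2 * s + 1
      too-short = begin-strict
        2 * d + m        ≤⟨ +-monoʳ-≤ (2 * d) m≤ℓ ⟩
        2 * d + ℓ        <⟨ +-monoʳ-< (2 * d) ℓ<2d ⟩
        2 * d + 2 * d    ≤⟨ +-mono-≤ 2d≤s 2d≤s ⟩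
        s + s            ≡⟨ cong (s +_) (+-identityʳ s) ⟨
        2 * s            ≤⟨ m≤m+n (2 * s) 1 ⟩
        2 * s + 1        ∎
        where open ≤-Reasoning

  adj⇒¬adj2 : ∀ {x z} → Adj G x z → adj2 G x z ≡ false
  adj⇒¬adj2 {x} {z} x~z with adj2 G x z in x≈z
  ... | true  = contradiction (step x~z here) (proj₂ (adj2⇒dist2 x≈z) 1 (s≤s (s≤s z≤n)))
  ... | false = refl

module Distance2GraphWalkRegularity
  (t k s : ℕ) (G : Graph) (2≤t : 2 ≤ t) (connected : Connected G) (walkRegular : WalkRegular G t)
  (regular : Regular G k) (oddGirth : OddGirth G (2 * s + 1)) where

  open Graph G using (n; adj) renaming (sym to adj-sym; irrefl to adj-irrefl)
  open WalkProperties G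
  open DistanceTwo G

  private
    distance2-pair : ∃₂ λ x z → Dist G x z 2
    distance2-pair = diameter⇒pairAtDistance 2≤t connected (proj₁ walkRegular)

    x₂ z₂ : Fin n
    x₂ = proj₁ distance2-pair
    z₂ = proj₁ (proj₂ distance2-pair)

    x₂-z₂ : Dist G x₂ z₂ 2
    x₂-z₂ = proj₂ (proj₂ distance2-pair)

    edge : ∃ λ z₁ → Dist G x₂ z₁ 1 × Dist G z₁ z₂ 1
    edge = dist-split 1 1 x₂-z₂

    z₁ : Fin n
    z₁ = proj₁ edge

    1≤t : 1 ≤ t
    1≤t = ≤-trans (s≤s z≤n) 2≤t

  μ λ′ : ℕ
  μ  = walks G 2 x₂ z₂
  λ′ = walks G 2 x₂ z₁

  instance
    μ-nonZero : NonZero μ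
    μ-nonZero = >-nonZero (walk⇒walks-pos (proj₁ x₂-z₂))

  walks-two-diagonal : ∀ x → walks G 2 x x ≡ k
  walks-two-diagonal x = trans (cong sum (map-cong closing-step (allFin n))) (regular x)
    where
    closing-step : ∀ w → (if adj x w then walks G 1 w x else 0) ≡ (if adj x w then 1 else 0)
    closing-step w rewrite WalkMatrices.walks-one G w x | adj-sym w x with adj x w
    ... | true  = refl
    ... | false = refl

  μA₂+λA+kI : Fin n → Fin n → ℕ
  μA₂+λA+kI x z = μ * walks G₂ 1 x z + λ′ * walks G 1 x z + k * walks G 0 x z

  private
    walks-one-with : ∀ H x z {b} → Graph.adj H x z ≡ b → walks H 1 x z ≡ (if b then 1 else 0)
    walks-one-with H x z e = trans (WalkMatrices.walks-one H x z) (cong (λ b → if b then 1 else 0) e)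

    μA₂+λA+kI-at : ∀ x z {a b c} → walks G₂ 1 x z ≡ a → walks G 1 x z ≡ b → walks G 0 x z ≡ c →
      μA₂+λA+kI x z ≡ μ * a + λ′ * b + k * c
    μA₂+λA+kI-at x z refl refl refl = refl

  A²-diagonal : ∀ x → walks G 2 x x ≡ μA₂+λA+kI x x
  A²-diagonal x = begin
    walks G 2 x x            ≡⟨ walks-two-diagonal x ⟩
    k                        ≡⟨ arithmetic μ λ′ k ⟩
    μ * 0 + λ′ * 0 + k * 1   ≡⟨ μA₂+λA+kI-at x x (walks-one-with G₂ x x (adj2-irrefl G x))
                                                 (walks-one-with G x x (adj-irrefl x)) (walks-zero-self x) ⟨
    μA₂+λA+kI x x            ∎
    where
    open ≡-Reasoning
    arithmetic : ∀ m l k → k ≡ m * 0 + l * 0 + k * 1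
    arithmetic = solve-∀

  A²-adjacent : ∀ {x z} → x ≢ z → Adj G x z → walks G 2 x z ≡ μA₂+λA+kI x z
  A²-adjacent {x} {z} x≢z x~z = begin
    walks G 2 x z            ≡⟨ proj₂ walkRegular 2 1 x z x₂ z₁ 1≤t (adj⇒dist1 x~z) (proj₁ (proj₂ edge)) ⟩
    λ′                       ≡⟨ arithmetic μ λ′ k ⟩
    μ * 0 + λ′ * 1 + k * 0   ≡⟨ μA₂+λA+kI-at x z (walks-one-with G₂ x z (adj⇒¬adj2 x~z))
                                                 (walks-one-with G x z x~z) (walks-zero-≢ x≢z) ⟨
    μA₂+λA+kI x z            ∎
    where
    open ≡-Reasoning
    arithmetic : ∀ m l k → l ≡ m * 0 + l * 1 + k * 0
    arithmetic = solve-∀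

  A²-distance2 : ∀ {x z} → x ≢ z → adj x z ≡ false → Adj G₂ x z → walks G 2 x z ≡ μA₂+λA+kI x z
  A²-distance2 {x} {z} x≢z x≁z x≈z = begin
    walks G 2 x z            ≡⟨ proj₂ walkRegular 2 2 x z x₂ z₂ 2≤t (adj2⇒dist2 x≈z) x₂-z₂ ⟩
    μ                        ≡⟨ arithmetic μ λ′ k ⟩
    μ * 1 + λ′ * 0 + k * 0   ≡⟨ μA₂+λA+kI-at x z (walks-one-with G₂ x z x≈z)
                                                 (walks-one-with G x z x≁z) (walks-zero-≢ x≢z) ⟨
    μA₂+λA+kI x z            ∎
    where
    open ≡-Reasoning
    arithmetic : ∀ m l k → m ≡ m * 1 + l * 0 + k * 0
    arithmetic = solve-∀

  A²-far : ∀ {x z} → x ≢ z → adj x z ≡ false → adj2 G x z ≡ false → walks G 2 x z ≡ μA₂+λA+kI x z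
  A²-far {x} {z} x≢z x≁z x≉z = begin
    walks G 2 x z            ≡⟨ ¬walk⇒walks≡0 no-walk ⟩
    0                        ≡⟨ arithmetic μ λ′ k ⟩
    μ * 0 + λ′ * 0 + k * 0   ≡⟨ μA₂+λA+kI-at x z (walks-one-with G₂ x z x≉z)
                                                 (walks-one-with G x z x≁z) (walks-zero-≢ x≢z) ⟨
    μA₂+λA+kI x z            ∎
    where
    open ≡-Reasoning
    no-walk : ¬ Walk G 2 x z
    no-walk w = contradiction (trans (sym (dist2⇒adj2 (w , no-walk-below-2 x≢z x≁z))) x≉z) λ ()
    arithmetic : ∀ m l k → 0 ≡ m * 0 + l * 0 + k * 0
    arithmetic = solve-∀

  A²-decomposition : ∀ x z → walks G 2 x z ≡ μA₂+λA+kI x z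
  A²-decomposition x z = by-equality (x F.≟ z)
    where
    -- Not `with x F.≟ z`: that would also abstract the test inside the unfolded walks G 0 x z.
    by-equality : Dec (x ≡ z) → walks G 2 x z ≡ μA₂+λA+kI x z
    by-equality (yes refl) = A²-diagonal x
    by-equality (no x≢z) with adj x z in x~z
    ... | true = A²-adjacent x≢z x~z
    ... | false with adj2 G x z in x≈z
    ...   | true  = A²-distance2 x≢z x~z x≈z
    ...   | false = A²-far x≢z x~z x≈z

  private
    r : ℕ
    r = (s / 2) ⊓ (t / 2)


  Γ₂-diameter : DiameterAtLeast G₂ r
  Γ₂-diameter with proj₁ walkRegular
  ... | x , y , far = x , y , λ ℓ ℓ<r w₂ → far (2 * ℓ) (2ℓ<t ℓ<r) (doubleWalk w₂)
    where
    2ℓ<t : ∀ {ℓ} → ℓ < r → 2 * ℓ < t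
    2ℓ<t {ℓ} ℓ<r = <-≤-trans (*-monoʳ-< 2 (n<1+n ℓ)) (m≤n/2⇒2*m≤n t (≤-trans ℓ<r (m⊓n≤n (s / 2) (t / 2))))

  Γ₂-walkCounts : ∀ ℓ d x y x′ y′ → d ≤ r → Dist G₂ x y d → Dist G₂ x′ y′ d →
    walks G₂ ℓ x y ≡ walks G₂ ℓ x′ y′
  Γ₂-walkCounts ℓ d x y x′ y′ d≤r D D′ =
    Distance2WalkCounts.distance2Walks-respect-walkCounts G μ λ′ k A²-decomposition sameWalkCounts ℓ
    where
    2d≤s : 2 * d ≤ s
    2d≤s = m≤n/2⇒2*m≤n s (≤-trans d≤r (m⊓n≤m (s / 2) (t / 2)))
    2d≤t : 2 * d ≤ t
    2d≤t = m≤n/2⇒2*m≤n t (≤-trans d≤r (m⊓n≤n (s / 2) (t / 2)))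
    sameWalkCounts : WalkMatrices.SameWalkCounts G x y x′ y′
    sameWalkCounts j =
      proj₂ walkRegular j (2 * d) x y x′ y′ 2d≤t (dist₂⇒dist oddGirth 2d≤s D) (dist₂⇒dist oddGirth 2d≤s D′)

-- In the paper, Γ not being complete multipartite makes Γ₂ connected; DiameterAtLeast also counts
-- pairs at infinite distance.
proposition3p2 : (t k s : ℕ) (G : Graph) → 2 ≤ t → Connected G → WalkRegular G t →
    Regular G k → OddGirth G (2 * s + 1) → ¬ CompleteMultipartite G →
    WalkRegular (Distance2Graph G) ((s / 2) ⊓ (t / 2))
proposition3p2 t k s G 2≤t connected walkRegular regular oddGirth _ = Γ₂-diameter , Γ₂-walkCounts
  where open Distance2GraphWalkRegularity t k s G 2≤t connected walkRegular regular oddGirth
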